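{- Let $\ell \ge 1$ be an integer and let $S=\{s_1,\ldots,s_m\}$ be a finite set of strings, each of length $\ell$, over some alphabet. Let $g$ be a shortest common superstring of $S$. Then for any string $r$ with $|r| > 2\ell-2$, $r$ occurs as a substring of $g$ in at most one location (i.e., there is at most one index $i$ with $g[i..i+|r|-1] = r$). In other words, a shortest common superstring of $S$ contains no repeat of length greater than $2\ell-2$.
   Context: A common superstring of $S$ is a string $g$ such that every $s_i \in S$ is a (contiguous) substring of $g$. A shortest common superstring is a common superstring of minimum length among all common superstrings of $S$. For a string $g$, $g[a..b]$ denotes the substring of $g$ from position $a$ to position $b$ inclusive. -}

module Defs where

open import Data.Nat using (ℕ; _+_; _≤_)
open import Data.List using (List; length; take; drop)
open import Data.List.Relation.Unary.All using (All)
open import Data.Product using (∃; _×_)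
open import Relation.Binary.PropositionalEquality using (_≡_)

-- r occurs in g at (0-based) position i, i.e. g[i .. i+|r|-1] = r.
OccursAt : {A : Set} → List A → List A → ℕ → Set
OccursAt r g i = (i + length r ≤ length g) × (take (length r) (drop i g) ≡ r)

IsSubstring : {A : Set} → List A → List A → Set
IsSubstring r g = ∃ λ i → OccursAt r g i

IsCommonSuperstring : {A : Set} → List (List A) → List A → Set
IsCommonSuperstring S g = All (λ s → IsSubstring s g) S

IsSCS : {A : Set} → List (List A) → List A → Set
IsSCS {A} S g = IsCommonSuperstring S g
  × ((h : List A) → IsCommonSuperstring S h → length g ≤ length h)

-- Let r occur in g at i < j, and let every string of S have length ℓ.  If the two
-- occurrences overlap by at least ℓ letters, cutting out g[i..j-1] keeps every string of S:
-- one lying in the first i + |r| letters is still there, since the copy of r at j now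
-- follows g[0..i-1], and any other starts after j.  Otherwise, when |r| > 2ℓ - 2, the
-- single letter at j + ℓ - 1 can be cut out: a string of S covering it spans at most
-- g[j..j+2ℓ-2], so it lies within the occurrence at j, hence also occurs inside the one
-- at i, which ends before that letter.
-- Either way g was not shortest.
module Submission where

open import Defs
open import Data.Nat using (ℕ; zero; suc; _+_; _*_; _∸_; _⊓_; _<_; _≤_; _≤?_; _<?_; s≤s⁻¹)
open import Data.Nat.Properties
open import Data.List using (List; []; _∷_; length; take; drop; _++_)
open import Data.List.Properties using (length-++; length-take; length-drop; take-take; take-drop; drop-drop; take-[])
open import Data.List.Relation.Unary.All as All using (All)
open import Data.Product using (_,_; proj₁; proj₂)
open import Data.Sum using (_⊎_; inj₁; inj₂)
open import Data.Empty using (⊥; ⊥-elim)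
open import Relation.Binary.Definitions using (tri<; tri≈; tri>)
open import Relation.Nullary using (¬_; yes; no)
open import Relation.Binary.PropositionalEquality

module _ {A : Set} where

  length-take-≤ : ∀ n (xs : List A) → n ≤ length xs → length (take n xs) ≡ n
  length-take-≤ n xs n≤ = trans (length-take n xs) (m≤n⇒m⊓n≡m n≤)

  take-+ : ∀ m n (xs : List A) → take (m + n) xs ≡ take m xs ++ take n (drop m xs)
  take-+ zero    n xs       = refl
  take-+ (suc m) n []       = sym (take-[] n)
  take-+ (suc m) n (x ∷ xs) = cong (x ∷_) (take-+ m n xs)

  take-++-length : ∀ n (xs ys : List A) → take (length xs + n) (xs ++ ys) ≡ xs ++ take n ys
  take-++-length n []       ys = refl
  take-++-length n (x ∷ xs) ys = cong (x ∷_) (take-++-length n xs ys)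

  drop-++-length : ∀ n (xs ys : List A) → drop (length xs + n) (xs ++ ys) ≡ drop n ys
  drop-++-length n []       ys = refl
  drop-++-length n (x ∷ xs) ys = drop-++-length n xs ys

  take-drop-take : ∀ t k n (xs : List A) → t + k ≤ n →
                   take k (drop t (take n xs)) ≡ take k (drop t xs)
  take-drop-take t k n xs t+k≤n = begin
    take k (drop t (take n xs))          ≡⟨ take-drop k t (take n xs) ⟩
    drop t (take (t + k) (take n xs))    ≡⟨ cong (drop t) (take-take (t + k) n xs) ⟩
    drop t (take ((t + k) ⊓ n) xs)       ≡⟨ cong (λ m → drop t (take m xs)) (m≤n⇒m⊓n≡m t+k≤n) ⟩
    drop t (take (t + k) xs)             ≡⟨ take-drop k t xs ⟨
    take k (drop t xs)                   ∎
    where open ≡-Reasoning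

  module _ {s g : List A} {p : ℕ} where

    occursAt-take : ∀ n → p + length s ≤ n → OccursAt s g p → OccursAt s (take n g) p
    occursAt-take n end≤n (end≤g , window) =
      subst (p + length s ≤_) (sym (length-take n g)) (⊓-glb end≤n end≤g) ,
      trans (take-drop-take p (length s) n g end≤n) window

    take-occursAt : ∀ n → OccursAt s (take n g) p → OccursAt s g p
    take-occursAt n (end≤ , window) =
      ≤-trans end≤′ (m⊓n≤n n (length g)) ,
      trans (sym (take-drop-take p (length s) n g (≤-trans end≤′ (m⊓n≤m n (length g))))) window
      where
      end≤′ : p + length s ≤ n ⊓ length g
      end≤′ = subst (p + length s ≤_) (length-take n g) end≤

  occursAt-prefix : ∀ {s g h : List A} {p} n → take n g ≡ take n h → p + length s ≤ n →
                    OccursAt s g p → OccursAt s h p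
  occursAt-prefix {s} {p = p} n same end≤n occ =
    take-occursAt n (subst (λ x → OccursAt s x p) same (occursAt-take n end≤n occ))

  occursAt-drop : ∀ {s g : List A} b {t} → OccursAt s g (b + t) → OccursAt s (drop b g) t
  occursAt-drop {s} {g} b {t} (end≤ , window) =
    subst (t + length s ≤_) (sym (length-drop b g)) (m+n≤o⇒m≤o∸n (t + length s) end≤′) ,
    trans (cong (take (length s)) (drop-drop b t g)) window
    where
    end≤′ : t + length s + b ≤ length g
    end≤′ = subst (_≤ length g) (trans (+-assoc b t (length s)) (+-comm b (t + length s))) end≤

  occursAt-++ : ∀ {s ys : List A} xs {t} → OccursAt s ys t → OccursAt s (xs ++ ys) (length xs + t)
  occursAt-++ {s} {ys} xs {t} (end≤ , window) =
    subst (λ m → m ≤ length (xs ++ ys)) (sym (+-assoc (length xs) t (length s)))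
      (subst (length xs + (t + length s) ≤_) (sym (length-++ xs)) (+-monoʳ-≤ (length xs) end≤)) ,
    trans (cong (take (length s)) (drop-++-length t xs ys)) window

  module _ {s r g : List A} {p t : ℕ} (r-at-p : OccursAt r g p) (s-in-r : t + length s ≤ length r) where

    private
      window-in-r : take (length s) (drop t r) ≡ take (length s) (drop (p + t) g)
      window-in-r = begin
        take (length s) (drop t r)                               ≡⟨ cong (λ x → take (length s) (drop t x)) (proj₂ r-at-p) ⟨
        take (length s) (drop t (take (length r) (drop p g)))    ≡⟨ take-drop-take t (length s) (length r) (drop p g) s-in-r ⟩
        take (length s) (drop t (drop p g))                      ≡⟨ cong (take (length s)) (drop-drop p t g) ⟩
        take (length s) (drop (p + t) g)                         ∎
        where open ≡-Reasoning

    occursAt-trans : OccursAt s r t → OccursAt s g (p + t)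
    occursAt-trans (_ , window) =
      subst (_≤ length g) (sym (+-assoc p t (length s))) (≤-trans (+-monoʳ-≤ p s-in-r) (proj₁ r-at-p)) ,
      trans (sym window-in-r) window

    occursAt-inside : OccursAt s g (p + t) → OccursAt s r t
    occursAt-inside (_ , window) = s-in-r , trans window-in-r window

  occursAt-repeat : ∀ {s r g : List A} {i j t} → OccursAt r g i → OccursAt r g j →
                    t + length s ≤ length r → OccursAt s g (j + t) → OccursAt s g (i + t)
  occursAt-repeat r-at-i r-at-j s-in-r s-at-j+t =
    occursAt-trans r-at-i s-in-r (occursAt-inside r-at-j s-in-r s-at-j+t)

  removeRange : ℕ → ℕ → List A → List A
  removeRange a b g = take a g ++ drop b g

  module _ {a b : ℕ} {g : List A} (a≤g : a ≤ length g) where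

    length-removeRange : length (removeRange a b g) ≡ a + (length g ∸ b)
    length-removeRange = trans (length-++ (take a g)) (cong₂ _+_ (length-take-≤ a g a≤g) (length-drop b g))

    removeRange-prefix : ∀ n → take n (drop a g) ≡ take n (drop b g) →
                         take (a + n) (removeRange a b g) ≡ take (a + n) g
    removeRange-prefix n same = begin
      take (a + n) (take a g ++ drop b g)               ≡⟨ cong (λ m → take (m + n) (take a g ++ drop b g)) (length-take-≤ a g a≤g) ⟨
      take (length (take a g) + n) (take a g ++ drop b g) ≡⟨ take-++-length n (take a g) (drop b g) ⟩
      take a g ++ take n (drop b g)                     ≡⟨ cong (take a g ++_) same ⟨
      take a g ++ take n (drop a g)                     ≡⟨ take-+ a n g ⟨
      take (a + n) g                                    ∎
      where open ≡-Reasoning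

    occursAt-removeRange : ∀ {s t} → OccursAt s g (b + t) → OccursAt s (removeRange a b g) (a + t)
    occursAt-removeRange {s} {t} occ =
      subst (λ m → OccursAt s (removeRange a b g) (m + t)) (length-take-≤ a g a≤g)
        (occursAt-++ (take a g) (occursAt-drop b occ))

    -- The window equation makes the removal leave the first a + n letters intact.
    isSubstring-removeRange : ∀ {s p} n → take n (drop a g) ≡ take n (drop b g) → OccursAt s g p →
                              p + length s ≤ a + n ⊎ b ≤ p → IsSubstring s (removeRange a b g)
    isSubstring-removeRange {p = p} n same occ (inj₁ end≤) =
      p , occursAt-prefix (a + n) (sym (removeRange-prefix n same)) end≤ occ
    isSubstring-removeRange {s} {p} n same occ (inj₂ b≤p) =
      a + (p ∸ b) , occursAt-removeRange (subst (OccursAt s g) (sym (m+[n∸m]≡n b≤p)) occ)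

  removeRange-shorter : ∀ {a b} {g : List A} → a < b → b ≤ length g → length (removeRange a b g) < length g
  removeRange-shorter {a} {b} {g} a<b b≤g = begin-strict
    length (removeRange a b g)  ≡⟨ length-removeRange {b = b} (≤-trans (<⇒≤ a<b) b≤g) ⟩
    a + (length g ∸ b)          <⟨ +-monoˡ-< (length g ∸ b) a<b ⟩
    b + (length g ∸ b)          ≡⟨ m+[n∸m]≡n b≤g ⟩
    length g                    ∎
    where open ≤-Reasoning

  module _ {ℓ : ℕ} {S : List (List A)} {g : List A}
           (uniform : All (λ s → length s ≡ ℓ) S) (scs : IsSCS S g) where

    IsSCS⇒¬removable : ∀ {a b} → a < b → b ≤ length g →
      ¬ (∀ {s} → length s ≡ ℓ → IsSubstring s g → IsSubstring s (removeRange a b g))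
    IsSCS⇒¬removable a<b b≤g keeps =
      <⇒≱ (removeRange-shorter a<b b≤g)
          (proj₂ scs _ (All.zipWith (λ (length≡ , occ) → keeps length≡ occ) (uniform , proj₁ scs)))

module _ {A : Set} {k : ℕ} {S : List (List A)} {g : List A}
         (uniform : All (λ s → length s ≡ suc k) S) (scs : IsSCS S g)
         {r : List A} {i j : ℕ} (i<j : i < j) (r-at-i : OccursAt r g i) (r-at-j : OccursAt r g j) where

  private
    L = length r

    j≤g : j ≤ length g
    j≤g = m+n≤o⇒m≤o j (proj₁ r-at-j)

  close-repeat : j + suc k ≤ i + L → ⊥
  close-repeat close = IsSCS⇒¬removable uniform scs i<j j≤g keeps
    where
    keeps : ∀ {s} → length s ≡ suc k → IsSubstring s g → IsSubstring s (removeRange i j g)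
    keeps {s} length≡ (p , s-at-p) =
      isSubstring-removeRange (≤-trans (<⇒≤ i<j) j≤g) L
        (trans (proj₂ r-at-i) (sym (proj₂ r-at-j))) s-at-p placement
      where
      placement : p + length s ≤ i + L ⊎ j ≤ p
      placement with p + length s ≤? i + L
      ... | yes fits = inj₁ fits
      ... | no ¬fits = inj₂ (<⇒≤ (+-cancelʳ-< (length s) j p
                              (≤-<-trans (subst (λ m → j + m ≤ i + L) (sym length≡) close) (≰⇒> ¬fits))))

  distant-repeat : k + k < L → i + L ≤ j + k → ⊥
  distant-repeat long far = IsSCS⇒¬removable uniform scs (n<1+n q) q<g keeps
    where
    q = j + k

    q<g : q < length g
    q<g = ≤-trans (+-monoʳ-< j (≤-<-trans (m≤m+n k k) long)) (proj₁ r-at-j)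

    keep-before : ∀ {s p} → p + length s ≤ q → OccursAt s g p → IsSubstring s (removeRange q (suc q) g)
    keep-before before occ =
      isSubstring-removeRange {b = suc q} (<⇒≤ q<g) 0 refl occ
        (inj₁ (≤-trans before (≤-reflexive (sym (+-identityʳ q)))))

    keeps : ∀ {s} → length s ≡ suc k → IsSubstring s g → IsSubstring s (removeRange q (suc q) g)
    keeps {s} length≡ (p , s-at-p) with p + length s ≤? q | q <? p
    ... | yes before | _       = keep-before before s-at-p
    ... | no _       | yes q<p = isSubstring-removeRange (<⇒≤ q<g) 0 refl s-at-p (inj₂ q<p)
    ... | no ¬before | no ¬q<p = keep-before ends-before copy
      where
      j≤p : j ≤ p
      j≤p = +-cancelʳ-≤ k j p (s≤s⁻¹ (subst (suc q ≤_) (trans (cong (p +_) length≡) (+-suc p k)) (≰⇒> ¬before)))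

      t = p ∸ j

      j+t≡p : j + t ≡ p
      j+t≡p = m+[n∸m]≡n j≤p

      t≤k : t ≤ k
      t≤k = +-cancelˡ-≤ j t k (subst (_≤ q) (sym j+t≡p) (≮⇒≥ ¬q<p))

      s-in-r : t + length s ≤ L
      s-in-r = subst (λ m → t + m ≤ L) (sym length≡)
                 (≤-trans (+-monoˡ-≤ (suc k) t≤k) (subst (_≤ L) (sym (+-suc k k)) long))

      copy : OccursAt s g (i + t)
      copy = occursAt-repeat r-at-i r-at-j s-in-r (subst (OccursAt s g) (sym j+t≡p) s-at-p)

      ends-before : i + t + length s ≤ q
      ends-before = subst (_≤ q) (sym (+-assoc i t (length s))) (≤-trans (+-monoʳ-≤ i s-in-r) far)

  no-long-repeat : k + k < L → ⊥
  no-long-repeat long with j + suc k ≤? i + L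
  ... | yes close = close-repeat close
  ... | no ¬close = distant-repeat long (s≤s⁻¹ (subst (suc (i + L) ≤_) (+-suc j k) (≰⇒> ¬close)))

2*[1+k]∸2≡k+k : ∀ k → 2 * suc k ∸ 2 ≡ k + k
2*[1+k]∸2≡k+k k = trans (cong (_∸ 1) (+-suc k (k + 0))) (cong (k +_) (+-identityʳ k))

theorem1 : {A : Set} (ℓ : ℕ) → 1 ≤ ℓ →
    (S : List (List A)) → All (λ s → length s ≡ ℓ) S →
    (g : List A) → IsSCS S g →
    (r : List A) → 2 * ℓ ∸ 2 < length r →
    (i j : ℕ) → OccursAt r g i → OccursAt r g j → i ≡ j
theorem1 zero ()
theorem1 (suc k) _ S uniform g scs r long i j r-at-i r-at-j
  rewrite 2*[1+k]∸2≡k+k k with <-cmp i j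
... | tri< i<j _ _ = ⊥-elim (no-long-repeat uniform scs i<j r-at-i r-at-j long)
... | tri≈ _ i≡j _ = i≡j
... | tri> _ _ j<i = ⊥-elim (no-long-repeat uniform scs j<i r-at-j r-at-i long)
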